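{- For every nonzero integer $m$ and every integer $n$, \[ \sum_{k = 1}^n L_{mk}^{\,4} = \frac{F_{2mn+m}\left(L_{2mn + m} + 4(-1)^{mn} L_m\right)}{F_{2m}} + 6n-5 . \]
   Context: $F_n$ and $L_n$ ($n\in\mathbb{Z}$) are the Fibonacci and Lucas numbers: $F_n=F_{n-1}+F_{n-2}$ with $F_0=0$, $F_1=1$; $L_n=L_{n-1}+L_{n-2}$ with $L_0=2$, $L_1=1$; extended to negative indices by $F_{ -n}=(-1)^{n-1}F_n$, $L_{ -n}=(-1)^nL_n$. For $n=0$ the sum $\sum_{k=1}^n$ is empty. For $n<0$ the sum follows the convention $\sum_{k=1}^n a_k=-\sum_{k=n+1}^{0}a_k$. -}

module Defs where

open import Data.Nat as ℕ using (ℕ; zero; suc)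
open import Data.Integer using (ℤ; +_; -[1+_]; _+_; _-_; _*_; -_)

fibℕ : ℕ → ℤ
fibℕ zero = + 0
fibℕ (suc zero) = + 1
fibℕ (suc (suc n)) = fibℕ (suc n) + fibℕ n

lucℕ : ℕ → ℤ
lucℕ zero = + 2
lucℕ (suc zero) = + 1
lucℕ (suc (suc n)) = lucℕ (suc n) + lucℕ n

sgnPow : ℕ → ℤ
sgnPow zero = + 1
sgnPow (suc n) = - sgnPow n

negOnePow : ℤ → ℤ
negOnePow (+ n) = sgnPow n
negOnePow -[1+ n ] = sgnPow (suc n)

-- F_{-n} = (-1)^(n-1) F_n,  L_{-n} = (-1)^n L_n
F : ℤ → ℤ
F (+ n) = fibℕ n
F -[1+ n ] = sgnPow n * fibℕ (suc n)

L : ℤ → ℤ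
L (+ n) = lucℕ n
L -[1+ n ] = sgnPow (suc n) * lucℕ (suc n)

sumℕ : (ℤ → ℤ) → ℕ → ℤ
sumℕ a zero = + 0
sumℕ a (suc n) = sumℕ a n + a (+ suc n)

-- Σ_{k=n+1}^{0} a k for n = -(j+1): terms k = -j, ..., 0
sumNeg : (ℤ → ℤ) → ℕ → ℤ
sumNeg a zero = a (+ 0)
sumNeg a (suc j) = sumNeg a j + a (- (+ suc j))

-- Σ_{k=1}^{n} a k with convention Σ_{k=1}^{n} = - Σ_{k=n+1}^{0} for n < 0
sumTo : (ℤ → ℤ) → ℤ → ℤ
sumTo a (+ n) = sumℕ a n
sumTo a -[1+ j ] = - sumNeg a j

{-# OPTIONS --safe #-}
module Submission where

-- With t = m(n+1), the increment of the right-hand side from n to n+1 is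
-- F_{2t+m} L_{2t+m} - F_{2t-m} L_{2t-m} + 4(-1)^t L_m (F_{2t+m} - (-1)^m F_{2t-m}),
-- which the addition formulas F_{a+b} - (-1)^b F_{a-b} = L_a F_b and F_{2c} = L_c F_c
-- turn into F_{2m} (L_{4t} + 4(-1)^t L_{2t}).  Squaring L_t^2 = L_{2t} + 2(-1)^t twice
-- shows this is F_{2m} (L_t^4 - 6), the increment of the left-hand side, so both sides
-- agree by induction in both directions from n = 0.  The addition formulas themselves
-- hold because both sides satisfy the Fibonacci recurrence in a and agree at a = 0, 1.

open import Data.Nat as ℕ using (ℕ; zero; suc)
import Data.Nat.Properties as ℕ
open import Data.Integer using (ℤ; +_; -[1+_]; _+_; _-_; _*_; -_; _^_)
open import Data.Integer.Properties using (+-0-abelianGroup; *-comm; neg-involutive; neg-distribʳ-*)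
open import Data.Integer.Tactic.RingSolver using (solve-∀)
open import Algebra.Bundles using (AbelianGroup)
open import Algebra.Properties.Group (AbelianGroup.group +-0-abelianGroup)
  using () renaming (∙-cancelˡ to +-cancelˡ; ∙-cancelʳ to +-cancelʳ)
open import Data.Product using (_×_; _,_; proj₁)
open import Relation.Binary.PropositionalEquality
  using (_≡_; _≢_; refl; sym; trans; cong; cong₂; subst; module ≡-Reasoning)
open ≡-Reasoning

open import Defs

ℤ-induction : (P : ℤ → Set) → P (+ 0) → (∀ z → P z → P (z + + 1)) →
              (∀ z → P (z + + 1) → P z) → ∀ z → P z
ℤ-induction P p₀ up down (+ zero)        = p₀
ℤ-induction P p₀ up down (+ suc n)       =
  subst P (cong +_ (ℕ.+-comm n 1)) (up (+ n) (ℤ-induction P p₀ up down (+ n)))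
ℤ-induction P p₀ up down -[1+ zero ]     = down -[1+ 0 ] p₀
ℤ-induction P p₀ up down -[1+ suc n ]    = down -[1+ suc n ] (ℤ-induction P p₀ up down -[1+ n ])

unique-by-increments : (f g d : ℤ → ℤ) → (∀ n → f (n + + 1) ≡ f n + d n) →
                       (∀ n → g (n + + 1) ≡ g n + d n) → f (+ 0) ≡ g (+ 0) → ∀ n → f n ≡ g n
unique-by-increments f g d f-step g-step f₀≡g₀ = ℤ-induction (λ n → f n ≡ g n) f₀≡g₀
  (λ n fn≡gn → trans (f-step n) (trans (cong (_+ d n) fn≡gn) (sym (g-step n))))
  (λ n fn+1≡gn+1 → +-cancelʳ (d n) (f n) (g n)
    (trans (sym (f-step n)) (trans fn+1≡gn+1 (g-step n))))

sumTo-suc : ∀ (a : ℤ → ℤ) n → sumTo a (n + + 1) ≡ sumTo a n + a (n + + 1)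
sumTo-suc a (+ k) rewrite ℕ.+-comm k 1 = refl
sumTo-suc a -[1+ zero ]  = sym (ring (a (+ 0)))
  where
  ring : ∀ x → - x + x ≡ + 0
  ring = solve-∀
sumTo-suc a -[1+ suc i ] = sym (ring (sumNeg a i) (a -[1+ i ]))
  where
  ring : ∀ x y → - (x + y) + y ≡ - x
  ring = solve-∀

sgnPow-square : ∀ n → sgnPow n * sgnPow n ≡ + 1
sgnPow-square zero    = refl
sgnPow-square (suc n) = trans (ring (sgnPow n)) (sgnPow-square n)
  where
  ring : ∀ s → (- s) * (- s) ≡ s * s
  ring = solve-∀

negOnePow-square : ∀ z → negOnePow z * negOnePow z ≡ + 1
negOnePow-square (+ n)    = sgnPow-square n
negOnePow-square -[1+ n ] = sgnPow-square (suc n)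

negOnePow-neg : ∀ z → negOnePow (- z) ≡ negOnePow z
negOnePow-neg (+ zero)  = refl
negOnePow-neg (+ suc n) = refl
negOnePow-neg -[1+ n ]  = refl

negOnePow-suc : ∀ z → negOnePow (z + + 1) ≡ - negOnePow z
negOnePow-suc (+ n)          = cong sgnPow (ℕ.+-comm n 1)
negOnePow-suc -[1+ zero ]    = refl
negOnePow-suc -[1+ suc n ]   = sym (neg-involutive (sgnPow (suc n)))

negOnePow-+ : ∀ a b → negOnePow (a + b) ≡ negOnePow a * negOnePow b
negOnePow-+ a = ℤ-induction (λ b → negOnePow (a + b) ≡ negOnePow a * negOnePow b)
  (trans (cong negOnePow (right-id a)) (sym (right-one (negOnePow a))))
  (λ b ih → begin
     negOnePow (a + (b + + 1))     ≡⟨ cong negOnePow (assoc a b) ⟩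
     negOnePow ((a + b) + + 1)     ≡⟨ negOnePow-suc (a + b) ⟩
     - negOnePow (a + b)           ≡⟨ cong -_ ih ⟩
     - (negOnePow a * negOnePow b) ≡⟨ neg-distribʳ-* (negOnePow a) (negOnePow b) ⟩
     negOnePow a * - negOnePow b   ≡⟨ cong (negOnePow a *_) (sym (negOnePow-suc b)) ⟩
     negOnePow a * negOnePow (b + + 1) ∎)
  (λ b ih → begin
     negOnePow (a + b)                ≡⟨ sym (neg-involutive _) ⟩
     - - negOnePow (a + b)            ≡⟨ cong -_ (sym (negOnePow-suc (a + b))) ⟩
     - negOnePow ((a + b) + + 1)      ≡⟨ cong (λ w → - negOnePow w) (sym (assoc a b)) ⟩
     - negOnePow (a + (b + + 1))      ≡⟨ cong -_ ih ⟩
     - (negOnePow a * negOnePow (b + + 1)) ≡⟨ cong (λ w → - (negOnePow a * w)) (negOnePow-suc b) ⟩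
     - (negOnePow a * - negOnePow b)  ≡⟨ neg-neg-right (negOnePow a) (negOnePow b) ⟩
     negOnePow a * negOnePow b ∎)
  where
  right-id : ∀ x → x + + 0 ≡ x
  right-id = solve-∀
  right-one : ∀ x → x * + 1 ≡ x
  right-one = solve-∀
  assoc : ∀ x y → x + (y + + 1) ≡ (x + y) + + 1
  assoc = solve-∀
  neg-neg-right : ∀ x y → - (x * - y) ≡ x * y
  neg-neg-right = solve-∀

negOnePow-double : ∀ z → negOnePow (z + z) ≡ + 1
negOnePow-double z = trans (negOnePow-+ z z) (negOnePow-square z)

negOnePow-pred : ∀ z → negOnePow (z - + 1) ≡ - negOnePow z
negOnePow-pred z = trans (negOnePow-+ z (- + 1)) (ring (negOnePow z))
  where
  ring : ∀ s → s * - + 1 ≡ - s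
  ring = solve-∀

record Recurrent (f : ℤ → ℤ) : Set where
  constructor recurrent
  field step : ∀ z → f (z + + 2) ≡ f (z + + 1) + f z

recurrent-unique : ∀ {f g} → Recurrent f → Recurrent g →
                   f (+ 0) ≡ g (+ 0) → f (+ 1) ≡ g (+ 1) → ∀ z → f z ≡ g z
recurrent-unique {f} {g} (recurrent rec-f) (recurrent rec-g) e₀ e₁ z =
  proj₁ (ℤ-induction AgreeAt (e₀ , e₁) up down z)
  where
  AgreeAt : ℤ → Set
  AgreeAt z = f z ≡ g z × f (z + + 1) ≡ g (z + + 1)
  two : ∀ z → (z + + 1) + + 1 ≡ z + + 2
  two = solve-∀
  up : ∀ z → AgreeAt z → AgreeAt (z + + 1)
  up z (a , b) = b , (begin
    f ((z + + 1) + + 1) ≡⟨ cong f (two z) ⟩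
    f (z + + 2)         ≡⟨ rec-f z ⟩
    f (z + + 1) + f z   ≡⟨ cong₂ _+_ b a ⟩
    g (z + + 1) + g z   ≡⟨ sym (rec-g z) ⟩
    g (z + + 2)         ≡⟨ cong g (sym (two z)) ⟩
    g ((z + + 1) + + 1) ∎)
  down : ∀ z → AgreeAt (z + + 1) → AgreeAt z
  down z (a , b) = +-cancelˡ (f (z + + 1)) (f z) (g z) (begin
    f (z + + 1) + f z ≡⟨ sym (rec-f z) ⟩
    f (z + + 2)       ≡⟨ cong f (sym (two z)) ⟩
    f ((z + + 1) + + 1) ≡⟨ b ⟩
    g ((z + + 1) + + 1) ≡⟨ cong g (two z) ⟩
    g (z + + 2)       ≡⟨ rec-g z ⟩
    g (z + + 1) + g z ≡⟨ cong (_+ g z) (sym a) ⟩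
    f (z + + 1) + g z ∎) , a

recurrent-shift : ∀ {f} c → Recurrent f → Recurrent (λ z → f (z + c))
recurrent-shift {f} c (recurrent rec-f) = recurrent λ z → begin
  f ((z + + 2) + c)         ≡⟨ cong f (ring₂ z c) ⟩
  f ((z + c) + + 2)         ≡⟨ rec-f (z + c) ⟩
  f ((z + c) + + 1) + f (z + c) ≡⟨ cong (λ w → f w + f (z + c)) (sym (ring₁ z c)) ⟩
  f ((z + + 1) + c) + f (z + c) ∎
  where
  ring₁ : ∀ z c → (z + + 1) + c ≡ (z + c) + + 1
  ring₁ = solve-∀
  ring₂ : ∀ z c → (z + + 2) + c ≡ (z + c) + + 2
  ring₂ = solve-∀

recurrent-+ : ∀ {f g} → Recurrent f → Recurrent g → Recurrent (λ z → f z + g z)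
recurrent-+ {f} {g} (recurrent rec-f) (recurrent rec-g) = recurrent λ z →
  trans (cong₂ _+_ (rec-f z) (rec-g z)) (ring (f (z + + 1)) (f z) (g (z + + 1)) (g z))
  where
  ring : ∀ a b c d → (a + b) + (c + d) ≡ (a + c) + (b + d)
  ring = solve-∀

recurrent-- : ∀ {f g} → Recurrent f → Recurrent g → Recurrent (λ z → f z - g z)
recurrent-- {f} {g} (recurrent rec-f) (recurrent rec-g) = recurrent λ z →
  trans (cong₂ _-_ (rec-f z) (rec-g z)) (ring (f (z + + 1)) (f z) (g (z + + 1)) (g z))
  where
  ring : ∀ a b c d → (a + b) - (c + d) ≡ (a - c) + (b - d)
  ring = solve-∀

recurrent-*ˡ : ∀ {f} c → Recurrent f → Recurrent (λ z → c * f z)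
recurrent-*ˡ {f} c (recurrent rec-f) = recurrent λ z →
  trans (cong (c *_) (rec-f z)) (ring c (f (z + + 1)) (f z))
  where
  ring : ∀ c a b → c * (a + b) ≡ c * a + c * b
  ring = solve-∀

recurrent-*ʳ : ∀ {f} c → Recurrent f → Recurrent (λ z → f z * c)
recurrent-*ʳ {f} c (recurrent rec-f) = recurrent λ z →
  trans (cong (_* c) (rec-f z)) (ring c (f (z + + 1)) (f z))
  where
  ring : ∀ c a b → (a + b) * c ≡ a * c + b * c
  ring = solve-∀

recurrent-pred : ∀ {f} → Recurrent f → ∀ z → f (+ 1 + z) ≡ f z + f (z - + 1)
recurrent-pred {f} (recurrent rec-f) z = begin
  f (+ 1 + z)                       ≡⟨ cong f (ring₂ z) ⟩
  f ((z - + 1) + + 2)               ≡⟨ rec-f (z - + 1) ⟩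
  f ((z - + 1) + + 1) + f (z - + 1) ≡⟨ cong (λ w → f w + f (z - + 1)) (ring₁ z) ⟩
  f z + f (z - + 1) ∎
  where
  ring₁ : ∀ z → (z - + 1) + + 1 ≡ z
  ring₁ = solve-∀
  ring₂ : ∀ z → + 1 + z ≡ (z - + 1) + + 2
  ring₂ = solve-∀

F-recurrent : Recurrent F
F-recurrent = recurrent step′
  where
  negative-step : ∀ s b c → s * b ≡ (- s) * (b + c) + (- - s) * ((b + c) + b)
  negative-step = solve-∀
  step′ : ∀ z → F (z + + 2) ≡ F (z + + 1) + F z
  step′ (+ n) rewrite ℕ.+-comm n 2 | ℕ.+-comm n 1 = refl
  step′ -[1+ zero ]        = refl
  step′ -[1+ suc zero ]    = refl
  step′ -[1+ suc (suc k) ] = negative-step (sgnPow k) (fibℕ (suc k)) (fibℕ k)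

L-recurrent : Recurrent L
L-recurrent = recurrent step′
  where
  negative-step : ∀ s b c → s * b ≡ (- s) * (b + c) + (- - s) * ((b + c) + b)
  negative-step = solve-∀
  step′ : ∀ z → L (z + + 2) ≡ L (z + + 1) + L z
  step′ (+ n) rewrite ℕ.+-comm n 2 | ℕ.+-comm n 1 = refl
  step′ -[1+ zero ]        = refl
  step′ -[1+ suc zero ]    = refl
  step′ -[1+ suc (suc k) ] = negative-step (sgnPow (suc k)) (lucℕ (suc k)) (lucℕ k)

F-neg : ∀ z → F (- z) ≡ - (negOnePow z * F z)
F-neg (+ zero)  = refl
F-neg (+ suc n) = ring (sgnPow n) (fibℕ (suc n))
  where
  ring : ∀ s x → s * x ≡ - ((- s) * x)
  ring = solve-∀
F-neg -[1+ n ]  = sym (begin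
  - ((- sgnPow n) * (sgnPow n * x)) ≡⟨ ring (sgnPow n) x ⟩
  (sgnPow n * sgnPow n) * x         ≡⟨ cong (_* x) (sgnPow-square n) ⟩
  + 1 * x                           ≡⟨ ring′ x ⟩
  x ∎)
  where
  x = fibℕ (suc n)
  ring : ∀ s x → - ((- s) * (s * x)) ≡ (s * s) * x
  ring = solve-∀
  ring′ : ∀ x → + 1 * x ≡ x
  ring′ = solve-∀

L-neg : ∀ z → L (- z) ≡ negOnePow z * L z
L-neg (+ zero)  = refl
L-neg (+ suc n) = refl
L-neg -[1+ n ]  = sym (begin
  s * (s * x) ≡⟨ ring s x ⟩
  (s * s) * x ≡⟨ cong (_* x) (sgnPow-square (suc n)) ⟩
  + 1 * x     ≡⟨ ring′ x ⟩
  x ∎)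
  where
  s = sgnPow (suc n)
  x = lucℕ (suc n)
  ring : ∀ s x → s * (s * x) ≡ (s * s) * x
  ring = solve-∀
  ring′ : ∀ x → + 1 * x ≡ x
  ring′ = solve-∀

F-addition : ∀ a b → F (a + b) - negOnePow b * F (a - b) ≡ L a * F b
F-addition a b = recurrent-unique
  (recurrent-- (recurrent-shift b F-recurrent) (recurrent-*ˡ s (recurrent-shift (- b) F-recurrent)))
  (recurrent-*ʳ (F b) L-recurrent)
  (begin
    F (+ 0 + b) - s * F (+ 0 - b)  ≡⟨ cong₂ (λ u v → F u - s * F v) (zero-+ b) (zero-- b) ⟩
    F b - s * F (- b)              ≡⟨ cong (λ u → F b - s * u) (F-neg b) ⟩
    F b - s * - (s * F b)          ≡⟨ ring₀ s (F b) ⟩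
    F b + (s * s) * F b            ≡⟨ cong (λ u → F b + u * F b) (negOnePow-square b) ⟩
    F b + + 1 * F b                ≡⟨ ring₀′ (F b) ⟩
    + 2 * F b ∎)
  (begin
    F (+ 1 + b) - s * F (+ 1 - b)
      ≡⟨ cong₂ (λ u v → u - s * v) (recurrent-pred F-recurrent b)
               (trans (cong F (one-- b)) (F-neg (b - + 1))) ⟩
    (F b + F (b - + 1)) - s * - (negOnePow (b - + 1) * F (b - + 1))
      ≡⟨ cong (λ u → (F b + F (b - + 1)) - s * - (u * F (b - + 1))) (negOnePow-pred b) ⟩
    (F b + F (b - + 1)) - s * - ((- s) * F (b - + 1))
      ≡⟨ ring₁ s (F b) (F (b - + 1)) ⟩
    F b + F (b - + 1) - (s * s) * F (b - + 1)
      ≡⟨ cong (λ u → F b + F (b - + 1) - u * F (b - + 1)) (negOnePow-square b) ⟩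
    F b + F (b - + 1) - + 1 * F (b - + 1)
      ≡⟨ ring₁′ (F b) (F (b - + 1)) ⟩
    + 1 * F b ∎)
  a
  where
  s = negOnePow b
  zero-+ : ∀ b → + 0 + b ≡ b
  zero-+ = solve-∀
  zero-- : ∀ b → + 0 - b ≡ - b
  zero-- = solve-∀
  one-- : ∀ b → + 1 - b ≡ - (b - + 1)
  one-- = solve-∀
  ring₀ : ∀ s x → x - s * - (s * x) ≡ x + (s * s) * x
  ring₀ = solve-∀
  ring₀′ : ∀ x → x + + 1 * x ≡ + 2 * x
  ring₀′ = solve-∀
  ring₁ : ∀ s x y → (x + y) - s * - ((- s) * y) ≡ x + y - (s * s) * y
  ring₁ = solve-∀
  ring₁′ : ∀ x y → x + y - + 1 * y ≡ + 1 * x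
  ring₁′ = solve-∀

L-addition : ∀ a b → L (a + b) + negOnePow b * L (a - b) ≡ L a * L b
L-addition a b = recurrent-unique
  (recurrent-+ (recurrent-shift b L-recurrent) (recurrent-*ˡ s (recurrent-shift (- b) L-recurrent)))
  (recurrent-*ʳ (L b) L-recurrent)
  (begin
    L (+ 0 + b) + s * L (+ 0 - b)  ≡⟨ cong₂ (λ u v → L u + s * L v) (zero-+ b) (zero-- b) ⟩
    L b + s * L (- b)              ≡⟨ cong (λ u → L b + s * u) (L-neg b) ⟩
    L b + s * (s * L b)            ≡⟨ ring₀ s (L b) ⟩
    L b + (s * s) * L b            ≡⟨ cong (λ u → L b + u * L b) (negOnePow-square b) ⟩
    L b + + 1 * L b                ≡⟨ ring₀′ (L b) ⟩
    + 2 * L b ∎)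
  (begin
    L (+ 1 + b) + s * L (+ 1 - b)
      ≡⟨ cong₂ (λ u v → u + s * v) (recurrent-pred L-recurrent b)
               (trans (cong L (one-- b)) (L-neg (b - + 1))) ⟩
    (L b + L (b - + 1)) + s * (negOnePow (b - + 1) * L (b - + 1))
      ≡⟨ cong (λ u → (L b + L (b - + 1)) + s * (u * L (b - + 1))) (negOnePow-pred b) ⟩
    (L b + L (b - + 1)) + s * ((- s) * L (b - + 1))
      ≡⟨ ring₁ s (L b) (L (b - + 1)) ⟩
    L b + L (b - + 1) - (s * s) * L (b - + 1)
      ≡⟨ cong (λ u → L b + L (b - + 1) - u * L (b - + 1)) (negOnePow-square b) ⟩
    L b + L (b - + 1) - + 1 * L (b - + 1)
      ≡⟨ ring₁′ (L b) (L (b - + 1)) ⟩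
    + 1 * L b ∎)
  a
  where
  s = negOnePow b
  zero-+ : ∀ b → + 0 + b ≡ b
  zero-+ = solve-∀
  zero-- : ∀ b → + 0 - b ≡ - b
  zero-- = solve-∀
  one-- : ∀ b → + 1 - b ≡ - (b - + 1)
  one-- = solve-∀
  ring₀ : ∀ s x → x + s * (s * x) ≡ x + (s * s) * x
  ring₀ = solve-∀
  ring₀′ : ∀ x → x + + 1 * x ≡ + 2 * x
  ring₀′ = solve-∀
  ring₁ : ∀ s x y → (x + y) + s * ((- s) * y) ≡ x + y - (s * s) * y
  ring₁ = solve-∀
  ring₁′ : ∀ x y → x + y - + 1 * y ≡ + 1 * x
  ring₁′ = solve-∀

F-double : ∀ c → F (c + c) ≡ L c * F c
F-double c = begin
  F (c + c)                             ≡⟨ ring (F (c + c)) (negOnePow c) ⟩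
  F (c + c) - negOnePow c * + 0         ≡⟨ cong (λ w → F (c + c) - negOnePow c * F w) (sym (self-- c)) ⟩
  F (c + c) - negOnePow c * F (c - c)   ≡⟨ F-addition c c ⟩
  L c * F c ∎
  where
  ring : ∀ x s → x ≡ x - s * + 0
  ring = solve-∀
  self-- : ∀ c → c - c ≡ + 0
  self-- = solve-∀

L-square : ∀ t → L t * L t ≡ L (t + t) + + 2 * negOnePow t
L-square t = begin
  L t * L t                               ≡⟨ sym (L-addition t t) ⟩
  L (t + t) + negOnePow t * L (t - t)     ≡⟨ cong (λ w → L (t + t) + negOnePow t * L w) (self-- t) ⟩
  L (t + t) + negOnePow t * + 2           ≡⟨ cong (λ w → L (t + t) + w) (*-comm (negOnePow t) (+ 2)) ⟩
  L (t + t) + + 2 * negOnePow t ∎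
  where
  self-- : ∀ c → c - c ≡ + 0
  self-- = solve-∀

L-fourth-power : ∀ t → L t ^ 4 ≡ L ((t + t) + (t + t)) + + 4 * negOnePow t * L (t + t) + + 6
L-fourth-power t = begin
  L t ^ 4                                  ≡⟨ fourth (L t) ⟩
  (L t * L t) * (L t * L t)                ≡⟨ cong (λ w → w * w) (L-square t) ⟩
  (L u + + 2 * s) * (L u + + 2 * s)        ≡⟨ expand (L u) s ⟩
  L u * L u + + 4 * s * L u + + 4 * (s * s)
    ≡⟨ cong₂ (λ x y → x + + 4 * s * L u + + 4 * y) (L-square u) (negOnePow-square t) ⟩
  L (u + u) + + 2 * negOnePow u + + 4 * s * L u + + 4 * + 1
    ≡⟨ cong (λ w → L (u + u) + + 2 * w + + 4 * s * L u + + 4 * + 1) (negOnePow-double t) ⟩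
  L (u + u) + + 2 * + 1 + + 4 * s * L u + + 4 * + 1 ≡⟨ collect (L (u + u)) s (L u) ⟩
  L (u + u) + + 4 * s * L u + + 6 ∎
  where
  u = t + t
  s = negOnePow t
  fourth : ∀ q → q * (q * (q * (q * + 1))) ≡ (q * q) * (q * q)
  fourth = solve-∀
  expand : ∀ x s → (x + + 2 * s) * (x + + 2 * s) ≡ x * x + + 4 * s * x + + 4 * (s * s)
  expand = solve-∀
  collect : ∀ x s y → x + + 2 * + 1 + + 4 * s * y + + 4 * + 1 ≡ x + + 4 * s * y + + 6
  collect = solve-∀

FL-difference : ∀ u m → F (u + m) * L (u + m) - F (u - m) * L (u - m) ≡ L (u + u) * F (m + m)
FL-difference u m = begin
  F (u + m) * L (u + m) - F (u - m) * L (u - m)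
    ≡⟨ cong₂ _-_ (FL-double (u + m)) (FL-double (u - m)) ⟩
  F ((u + m) + (u + m)) - F ((u - m) + (u - m))
    ≡⟨ cong₂ (λ x y → F x - F y) (regroup₊ u m) (regroup₋ u m) ⟩
  F ((u + u) + (m + m)) - F ((u + u) - (m + m))
    ≡⟨ cong (λ w → F ((u + u) + (m + m)) - w) (sym (one-* (F ((u + u) - (m + m))))) ⟩
  F ((u + u) + (m + m)) - + 1 * F ((u + u) - (m + m))
    ≡⟨ cong (λ w → F ((u + u) + (m + m)) - w * F ((u + u) - (m + m))) (sym (negOnePow-double m)) ⟩
  F ((u + u) + (m + m)) - negOnePow (m + m) * F ((u + u) - (m + m))
    ≡⟨ F-addition (u + u) (m + m) ⟩
  L (u + u) * F (m + m) ∎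
  where
  FL-double : ∀ c → F c * L c ≡ F (c + c)
  FL-double c = trans (*-comm (F c) (L c)) (sym (F-double c))
  regroup₊ : ∀ u m → (u + m) + (u + m) ≡ (u + u) + (m + m)
  regroup₊ = solve-∀
  regroup₋ : ∀ u m → (u - m) + (u - m) ≡ (u + u) - (m + m)
  regroup₋ = solve-∀
  one-* : ∀ x → + 1 * x ≡ x
  one-* = solve-∀

scaledSum : ℤ → ℤ → ℤ
scaledSum m n = F (+ 2 * m) * (sumTo (λ k → L (m * k) ^ 4) n - (+ 6 * n - + 5))

closedForm : ℤ → ℤ → ℤ
closedForm m n = F (+ 2 * m * n + m) * (L (+ 2 * m * n + m) + + 4 * negOnePow (m * n) * L m)

increment : ℤ → ℤ → ℤ
increment m n = F (+ 2 * m) * (L (m * (n + + 1)) ^ 4 - + 6)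

F-2* : ∀ m → F (+ 2 * m) ≡ L m * F m
F-2* m = trans (cong F (two-* m)) (F-double m)
  where
  two-* : ∀ m → + 2 * m ≡ m + m
  two-* = solve-∀

scaledSum≡closedForm-0 : ∀ m → scaledSum m (+ 0) ≡ closedForm m (+ 0)
scaledSum≡closedForm-0 m = begin
  F (+ 2 * m) * (+ 0 - (+ 6 * + 0 - + 5))  ≡⟨ cong (λ w → w * (+ 0 - (+ 6 * + 0 - + 5))) (F-2* m) ⟩
  (L m * F m) * (+ 0 - (+ 6 * + 0 - + 5))  ≡⟨ ring (L m) (F m) ⟩
  F m * (L m + + 4 * + 1 * L m)            ≡⟨ cong₂ (λ c k → F c * (L c + + 4 * negOnePow k * L m))
                                                     (sym (index m)) (sym (times-0 m)) ⟩
  closedForm m (+ 0) ∎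
  where
  ring : ∀ l f → (l * f) * (+ 0 - (+ 6 * + 0 - + 5)) ≡ f * (l + + 4 * + 1 * l)
  ring = solve-∀
  index : ∀ m → + 2 * m * + 0 + m ≡ m
  index = solve-∀
  times-0 : ∀ m → m * + 0 ≡ + 0
  times-0 = solve-∀

scaledSum-suc : ∀ m n → scaledSum m (n + + 1) ≡ scaledSum m n + increment m n
scaledSum-suc m n =
  trans (cong (λ w → F (+ 2 * m) * (w - (+ 6 * (n + + 1) - + 5))) (sumTo-suc (λ k → L (m * k) ^ 4) n))
        (ring (F (+ 2 * m)) (sumTo (λ k → L (m * k) ^ 4) n) (L (m * (n + + 1)) ^ 4) n)
  where
  ring : ∀ f s x n → f * ((s + x) - (+ 6 * (n + + 1) - + 5)) ≡ f * (s - (+ 6 * n - + 5)) + f * (x - + 6)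
  ring = solve-∀

closedForm-suc : ∀ m n → closedForm m (n + + 1) ≡ closedForm m n + increment m n
closedForm-suc m n = begin
  closedForm m (n + + 1)
    ≡⟨ cong (λ c → F c * (L c + + 4 * s * L m)) (index₊ m n) ⟩
  F (u + m) * (L (u + m) + + 4 * s * L m)
    ≡⟨ split (F (u + m)) (L (u + m)) (F (u - m)) (L (u - m)) s r (L m) ⟩
  F (u - m) * (L (u - m) + + 4 * (s * r) * L m)
    + (F (u + m) * L (u + m) - F (u - m) * L (u - m))
    + + 4 * s * L m * (F (u + m) - r * F (u - m))
    ≡⟨ cong₂ (λ x y → F (u - m) * (L (u - m) + + 4 * (s * r) * L m) + x + + 4 * s * L m * y)
             (FL-difference u m) (F-addition u m) ⟩
  F (u - m) * (L (u - m) + + 4 * (s * r) * L m) + L (u + u) * F (m + m) + + 4 * s * L m * (L u * F m)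
    ≡⟨ cong (λ w → F (u - m) * (L (u - m) + + 4 * (s * r) * L m) + L (u + u) * w
                   + + 4 * s * L m * (L u * F m)) (F-double m) ⟩
  F (u - m) * (L (u - m) + + 4 * (s * r) * L m) + L (u + u) * (L m * F m) + + 4 * s * L m * (L u * F m)
    ≡⟨ factor (F (u - m) * (L (u - m) + + 4 * (s * r) * L m)) (L m) (F m) (L (u + u)) s (L u) ⟩
  F (u - m) * (L (u - m) + + 4 * (s * r) * L m) + (L m * F m) * ((L (u + u) + + 4 * s * L u + + 6) - + 6)
    ≡⟨ cong₂ _+_ (cong₂ (λ c σ → F c * (L c + + 4 * σ * L m)) (sym (index₋ m n)) (sym sign))
                 (cong₂ (λ f q → f * (q - + 6)) (sym (F-2* m)) (sym (L-fourth-power t))) ⟩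
  closedForm m n + increment m n ∎
  where
  t = m * (n + + 1)
  u = t + t
  s = negOnePow t
  r = negOnePow m
  index₊ : ∀ m n → + 2 * m * (n + + 1) + m ≡ (m * (n + + 1) + m * (n + + 1)) + m
  index₊ = solve-∀
  index₋ : ∀ m n → + 2 * m * n + m ≡ (m * (n + + 1) + m * (n + + 1)) - m
  index₋ = solve-∀
  sign : negOnePow (m * n) ≡ s * r
  sign = begin
    negOnePow (m * n)           ≡⟨ cong negOnePow (shift m n) ⟩
    negOnePow (t + - m)         ≡⟨ negOnePow-+ t (- m) ⟩
    s * negOnePow (- m)         ≡⟨ cong (s *_) (negOnePow-neg m) ⟩
    s * r ∎
    where
    shift : ∀ m n → m * n ≡ m * (n + + 1) + - m
    shift = solve-∀
  split : ∀ A₁ B₁ A₀ B₀ s r l → A₁ * (B₁ + + 4 * s * l)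
    ≡ A₀ * (B₀ + + 4 * (s * r) * l) + (A₁ * B₁ - A₀ * B₀) + + 4 * s * l * (A₁ - r * A₀)
  split = solve-∀
  factor : ∀ X l f v s w → X + v * (l * f) + + 4 * s * l * (w * f)
    ≡ X + (l * f) * ((v + + 4 * s * w + + 6) - + 6)
  factor = solve-∀

mainTheorem2 : (m n : ℤ) → m ≢ + 0 →
    F (+ 2 * m) * (sumTo (λ k → L (m * k) ^ 4) n - (+ 6 * n - + 5))
    ≡ F (+ 2 * m * n + m) * (L (+ 2 * m * n + m) + + 4 * negOnePow (m * n) * L m)
mainTheorem2 m n _ =
  unique-by-increments (scaledSum m) (closedForm m) (increment m)
    (scaledSum-suc m) (closedForm-suc m) (scaledSum≡closedForm-0 m) n
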